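{- Let $N\ge 2$, let $n_1\ge 0$ and $n_2,\dots,n_N\ge 1$ be integers, $|n|=n_2+\cdots+n_N$, and consider the complete $N$-partite graph $K_{n_1,\dots,n_N}$ with parts $V_1,\dots,V_N$, $|V_i|=n_i$, where the vertices of $V_1$ are labeled and the vertices within each of $V_2,\dots,V_N$ are regarded as unlabeled (i.e. acyclic orientations are counted up to permutations of the vertices inside each of $V_2,\dots,V_N$; equivalently, as orbits under $\mathrm{Sym}(V_2)\times\cdots\times\mathrm{Sym}(V_N)$). Call this $K'_{n_1,\dots,n_N}$. Then the number of acyclic orientations of $K'_{n_1,\dots,n_N}$ is \[ (1+|n|)^{n_1}\binom{|n|}{n_2,\dots,n_N}. \]
   Context: In $K_{n_1,\dots,n_N}$ two vertices are adjacent iff they lie in different parts. An acyclic orientation directs every edge with no directed cycle. $\binom{|n|}{n_2,\dots,n_N}=\frac{|n|!}{n_2!\cdots n_N!}$ is the multinomial coefficient. -}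

module Defs where

open import Data.Nat using (ℕ; zero; suc; _+_; _*_; _^_; _/_; NonZero; _!)
open import Data.Nat.Properties using (_!≢0; m*n≢0)

open import Data.Fin using (Fin; zero; suc)
open import Data.Fin.Permutation using (Permutation′; _⟨$⟩ʳ_)
open import Data.Bool using (Bool; true; false; not)
open import Data.Product using (Σ; _×_; _,_; proj₁; ∃)
open import Relation.Binary.PropositionalEquality using (_≡_; _≢_)
open import Relation.Binary.Construct.Closure.Transitive using (TransClosure)
open import Relation.Nullary using (¬_)

Σ[<_]_ : (k : ℕ) → (Fin k → ℕ) → ℕ
Σ[< zero ] f = 0
Σ[< suc k ] f = f zero + Σ[< k ] (λ i → f (suc i))

∏[<_]_ : (k : ℕ) → (Fin k → ℕ) → ℕ
∏[< zero ] f = 1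
∏[< suc k ] f = f zero * ∏[< k ] (λ i → f (suc i))

∏!≢0 : (k : ℕ) (f : Fin k → ℕ) → NonZero (∏[< k ] (λ i → f i !))
∏!≢0 zero f = _
∏!≢0 (suc k) f = m*n≢0 (f zero !) _ {{f zero !≢0}} {{∏!≢0 k (λ i → f (suc i))}}

multinomial : (k : ℕ) → (Fin k → ℕ) → ℕ
multinomial k a = ((Σ[< k ] a) ! / ∏[< k ] (λ i → a i !)) {{∏!≢0 k a}}

-- Complete (M+1)-partite graph with parts indexed by Fin (suc M);
-- part `zero` is V₁ (size n zero), parts `suc i` are V₂,…,V_N.
Vertex : (M : ℕ) → (Fin (suc M) → ℕ) → Set
Vertex M n = Σ (Fin (suc M)) (λ i → Fin (n i))

Adj : ∀ {M n} → Vertex M n → Vertex M n → Set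
Adj u v = proj₁ u ≢ proj₁ v

-- An orientation: o u v ≡ true means the edge is directed u → v.
-- Non-edges carry no arrow; each edge gets exactly one direction.
IsOrientation : ∀ {M n} → (Vertex M n → Vertex M n → Bool) → Set
IsOrientation {M} {n} o =
  (u v : Vertex M n) → (proj₁ u ≡ proj₁ v → o u v ≡ false) × (Adj u v → o u v ≡ not (o v u))

Acyclic : ∀ {M n} → (Vertex M n → Vertex M n → Bool) → Set
Acyclic {M} {n} o = (v : Vertex M n) → ¬ TransClosure (λ a b → o a b ≡ true) v v

AcyclicOrientation : (M : ℕ) → (Fin (suc M) → ℕ) → Set
AcyclicOrientation M n =
  Σ (Vertex M n → Vertex M n → Bool) (λ o → IsOrientation o × Acyclic o)

PartPerm : (M : ℕ) → (Fin (suc M) → ℕ) → Set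
PartPerm M n = (i : Fin M) → Permutation′ (n (suc i))

act : ∀ {M n} → PartPerm M n → Vertex M n → Vertex M n
act π (zero , a) = (zero , a)
act π (suc i , a) = (suc i , π i ⟨$⟩ʳ a)

SameOrbit : ∀ {M n} → AcyclicOrientation M n → AcyclicOrientation M n → Set
SameOrbit {M} {n} (o , _) (o' , _) =
  ∃ λ (π : PartPerm M n) → (u v : Vertex M n) → o' (act π u) (act π v) ≡ o u v

-- A type A with relation _~_ has exactly k classes: a bijection Fin k ≃ A/~.
HasClasses : (A : Set) → (A → A → Set) → ℕ → Set
HasClasses A _~_ k =
  Σ (Fin k → A) λ f → Σ (A → Fin k) λ g →
    ((a b : A) → a ~ b → g a ≡ g b) ×
    ((i : Fin k) → g (f i) ≡ i) ×
    ((a : A) → f (g a) ~ a)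

-- Any two vertices in different parts are adjacent, so in an acyclic orientation the vertices outside V₁,
-- sorted by the number of vertices outside V₁ that reach them, form a chain up to reordering inside a part.
-- Modulo Sym(V₂) × ⋯ × Sym(V_N) this chain is a word of length |n| with n_i letters i, and there are
-- multinomial(|n|; n₂, …, n_N) such words; each vertex of V₁ independently occupies one of the |n| + 1 gaps
-- of the chain.  Conversely a word and a choice of gaps define a canonical orientation, directing every edge
-- upwards for suitable heights.  Positions and gaps are read off from the number of vertices outside V₁
-- pointing into each vertex, which the group action preserves, so distinct data lie in distinct orbits.

module Submission where

open import Defs
open import Data.Nat using (ℕ; zero; suc; _+_; _*_; _^_; _≤_; _<_; z≤n; s≤s; s≤s⁻¹; s<s⁻¹; pred; _!; _/_; _<?_)
open import Data.Nat.Properties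
open import Data.Nat.DivMod using (m*n/n≡m)
open import Data.Fin as Fin using (Fin; zero; suc; toℕ; fromℕ<; _↑ˡ_; _↑ʳ_; splitAt)
open import Data.Fin.Properties as Finₚ
  using (toℕ-injective; toℕ<n; toℕ-fromℕ<; splitAt-↑ˡ; splitAt-↑ʳ; splitAt⁻¹-↑ˡ; splitAt⁻¹-↑ʳ)
open import Data.Fin.Permutation as Perm using (Permutation′; permutation; _⟨$⟩ʳ_; _⟨$⟩ˡ_; inverseˡ; inverseʳ; _∘ₚ_)
open import Data.Vec using (Vec; []; _∷_; lookup; tabulate)
open import Data.Vec.Properties using (tabulate-cong; tabulate∘lookup; lookup∘tabulate)
open import Data.Vec.Functional using (updateAt)
open import Data.Vec.Functional.Properties using (updateAt-updates; updateAt-minimal)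
open import Data.Bool using (Bool; true; false; not; _∧_) renaming (_≟_ to _≟ᵇ_)
open import Data.Bool.Properties using (¬-not; ∧-zeroʳ; ∧-identityʳ)
open import Data.Product using (Σ; _×_; _,_; proj₁; proj₂; ∃)
open import Data.Sum using (inj₁; inj₂)
open import Function using (_∘_)
open import Function.Definitions using (Injective)
open import Function.Bundles using (_⇔_; mk⇔; module Equivalence)
open import Relation.Binary.Definitions using (tri<; tri≈; tri>)
open import Relation.Binary.PropositionalEquality
open import Relation.Binary.Construct.Closure.Transitive using (TransClosure; [_]; _∷_; _++_)
open import Relation.Nullary using (Dec; yes; no; does; ¬_; contradiction)
open import Relation.Nullary.Decidable using (dec-true; dec-false; does-⇔; map′; _×-dec_)
open import Algebra.Properties.CommutativeSemigroup +-commutativeSemigroup using (interchange)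
open import Algebra.Properties.CommutativeSemigroup *-commutativeSemigroup using (x∙yz≈y∙xz)
open import Algebra.Properties.CommutativeMonoid.Sum +-0-commutativeMonoid using (sum; sum-permute)

dec-true⁻¹ : ∀ {P : Set} (P? : Dec P) → does P? ≡ true → P
dec-true⁻¹ (yes p) _ = p

<?-cong : ∀ {a b c d} → a < b ⇔ c < d → does (a <? b) ≡ does (c <? d)
<?-cong {a} {b} {c} {d} eq = does-⇔ eq (a <? b) (c <? d)

-- Sums and counts over Fin k

Σ-cong : ∀ k {f g : Fin k → ℕ} → (∀ i → f i ≡ g i) → Σ[< k ] f ≡ Σ[< k ] g
Σ-cong zero    eq = refl
Σ-cong (suc k) eq = cong₂ _+_ (eq zero) (Σ-cong k (eq ∘ suc))

Σ-mono-≤ : ∀ k {f g : Fin k → ℕ} → (∀ i → f i ≤ g i) → Σ[< k ] f ≤ Σ[< k ] g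
Σ-mono-≤ zero    le = z≤n
Σ-mono-≤ (suc k) le = +-mono-≤ (le zero) (Σ-mono-≤ k (le ∘ suc))

Σ-mono-< : ∀ k {f g : Fin k → ℕ} → (∀ i → f i ≤ g i) → (j : Fin k) → f j < g j →
           Σ[< k ] f < Σ[< k ] g
Σ-mono-< (suc k) le zero    lt = +-mono-<-≤ lt (Σ-mono-≤ k (le ∘ suc))
Σ-mono-< (suc k) le (suc j) lt = +-mono-≤-< (le zero) (Σ-mono-< k (le ∘ suc) j lt)

Σ-distrib-+ : ∀ k (f g : Fin k → ℕ) → Σ[< k ] (λ i → f i + g i) ≡ Σ[< k ] f + Σ[< k ] g
Σ-distrib-+ zero    f g = refl
Σ-distrib-+ (suc k) f g = trans (cong (f zero + g zero +_) (Σ-distrib-+ k (f ∘ suc) (g ∘ suc)))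
                                (interchange (f zero) (g zero) _ _)

Σ-distribʳ-* : ∀ k (f : Fin k → ℕ) a → Σ[< k ] (λ i → f i * a) ≡ Σ[< k ] f * a
Σ-distribʳ-* zero    f a = refl
Σ-distribʳ-* (suc k) f a =
  trans (cong (f zero * a +_) (Σ-distribʳ-* k (f ∘ suc) a)) (sym (*-distribʳ-+ a (f zero) _))

Σ-zero : ∀ k → Σ[< k ] (λ _ → 0) ≡ 0
Σ-zero zero    = refl
Σ-zero (suc k) = Σ-zero k

Σ≡0⇒≡0 : ∀ k (f : Fin k → ℕ) → Σ[< k ] f ≡ 0 → ∀ i → f i ≡ 0
Σ≡0⇒≡0 (suc k) f e zero    = m+n≡0⇒m≡0 (f zero) e
Σ≡0⇒≡0 (suc k) f e (suc i) = Σ≡0⇒≡0 k (f ∘ suc) (m+n≡0⇒n≡0 (f zero) e) i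

Σ-single : ∀ k (f : Fin k → ℕ) i → (∀ j → j ≢ i → f j ≡ 0) → Σ[< k ] f ≡ f i
Σ-single (suc k) f zero    h =
  trans (cong (f zero +_) (trans (Σ-cong k (λ j → h (suc j) λ ())) (Σ-zero k))) (+-identityʳ _)
Σ-single (suc k) f (suc i) h =
  cong₂ _+_ (h zero λ ()) (Σ-single k (f ∘ suc) i (λ j j≢i → h (suc j) (j≢i ∘ Finₚ.suc-injective)))

Σ≡sum : ∀ k (f : Fin k → ℕ) → Σ[< k ] f ≡ sum f
Σ≡sum zero    f = refl
Σ≡sum (suc k) f = cong (f zero +_) (Σ≡sum k (f ∘ suc))

Σ-permute : ∀ k (f : Fin k → ℕ) (π : Permutation′ k) → Σ[< k ] (λ i → f (π ⟨$⟩ʳ i)) ≡ Σ[< k ] f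
Σ-permute k f π = begin
  Σ[< k ] (λ i → f (π ⟨$⟩ʳ i)) ≡⟨ Σ≡sum k _ ⟩
  sum (λ i → f (π ⟨$⟩ʳ i))      ≡⟨ sum-permute f π ⟨
  sum f                         ≡⟨ Σ≡sum k f ⟨
  Σ[< k ] f                     ∎
  where open ≡-Reasoning

bit : Bool → ℕ
bit true  = 1
bit false = 0

count : (k : ℕ) → (Fin k → Bool) → ℕ
count k P = Σ[< k ] (λ i → bit (P i))

count-cong : ∀ k {P Q : Fin k → Bool} → (∀ i → P i ≡ Q i) → count k P ≡ count k Q
count-cong k eq = Σ-cong k (cong bit ∘ eq)

count≤ : ∀ k P → count k P ≤ k
count≤ zero    P = z≤n
count≤ (suc k) P = +-mono-≤ (bit≤1 (P zero)) (count≤ k (P ∘ suc))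
  where
  bit≤1 : ∀ b → bit b ≤ 1
  bit≤1 true  = s≤s z≤n
  bit≤1 false = z≤n

bit-mono : ∀ {a b} → (a ≡ true → b ≡ true) → bit a ≤ bit b
bit-mono {true}  a⇒b rewrite a⇒b refl = ≤-refl
bit-mono {false} a⇒b = z≤n

count-mono : ∀ k {P Q : Fin k → Bool} → (∀ i → P i ≡ true → Q i ≡ true) → count k P ≤ count k Q
count-mono k P⇒Q = Σ-mono-≤ k (bit-mono ∘ P⇒Q)

count-mono-< : ∀ k {P Q : Fin k → Bool} → (∀ i → P i ≡ true → Q i ≡ true) →
               ∀ j → P j ≡ false → Q j ≡ true → count k P < count k Q
count-mono-< k P⇒Q j Pj Qj =
  Σ-mono-< k (bit-mono ∘ P⇒Q) j (subst₂ (λ a b → bit a < bit b) (sym Pj) (sym Qj) ≤-refl)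

count-permute : ∀ k (P : Fin k → Bool) (π : Permutation′ k) → count k (λ i → P (π ⟨$⟩ʳ i)) ≡ count k P
count-permute k P = Σ-permute k (bit ∘ P)

count-none : ∀ k (P : Fin k → Bool) → (∀ i → P i ≡ false) → count k P ≡ 0
count-none k P none = trans (count-cong k none) (Σ-zero k)

count-all : ∀ k (P : Fin k → Bool) → (∀ i → P i ≡ true) → count k P ≡ k
count-all zero    P all = refl
count-all (suc k) P all rewrite all zero = cong suc (count-all k (P ∘ suc) (all ∘ suc))

count-partition : ∀ k (b Q : Fin k → Bool) →
                  count k Q ≡ count k (λ i → not (b i) ∧ Q i) + count k (λ i → b i ∧ Q i)
count-partition k b Q = trans (Σ-cong k (λ i → split (b i) (Q i))) (Σ-distrib-+ k _ _)
  where
  split : ∀ x y → bit y ≡ bit (not x ∧ y) + bit (x ∧ y)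
  split true  y = refl
  split false y = sym (+-identityʳ _)

count-toℕ< : ∀ k p → p ≤ k → count k (λ i → does (toℕ i <? p)) ≡ p
count-toℕ< k       zero    _  = count-none k _ (λ i → dec-false (toℕ i <? 0) λ ())
count-toℕ< (suc k) (suc p) le = cong suc (count-toℕ< k p (≤-pred le))

joinΣ : ∀ k (x : Fin k → ℕ) → Σ (Fin k) (Fin ∘ x) → Fin (Σ[< k ] x)
joinΣ (suc k) x (zero  , a) = a ↑ˡ _
joinΣ (suc k) x (suc i , a) = x zero ↑ʳ joinΣ k (x ∘ suc) (i , a)

splitΣ : ∀ k (x : Fin k → ℕ) → Fin (Σ[< k ] x) → Σ (Fin k) (Fin ∘ x)
splitΣ (suc k) x z with splitAt (x zero) z
... | inj₁ a = zero , a
... | inj₂ r with splitΣ k (x ∘ suc) r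
...   | i , a = suc i , a

splitΣ-joinΣ : ∀ k x p → splitΣ k x (joinΣ k x p) ≡ p
splitΣ-joinΣ (suc k) x (zero  , a) rewrite splitAt-↑ˡ (x zero) a (Σ[< k ] (x ∘ suc)) = refl
splitΣ-joinΣ (suc k) x (suc i , a)
  rewrite splitAt-↑ʳ (x zero) (Σ[< k ] (x ∘ suc)) (joinΣ k (x ∘ suc) (i , a))
        | splitΣ-joinΣ k (x ∘ suc) (i , a) = refl

joinΣ-splitΣ : ∀ k x z → joinΣ k x (splitΣ k x z) ≡ z
joinΣ-splitΣ (suc k) x z with splitAt (x zero) z in eq
... | inj₁ a = splitAt⁻¹-↑ˡ eq
... | inj₂ r with splitΣ k (x ∘ suc) r in eq′
...   | i , a = trans (cong (x zero ↑ʳ_) (trans (cong (joinΣ k (x ∘ suc)) (sym eq′))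
                                                (joinΣ-splitΣ k (x ∘ suc) r)))
                      (splitAt⁻¹-↑ʳ eq)

count-+ : ∀ m k (Q : Fin (m + k) → Bool) →
          count (m + k) Q ≡ count m (λ a → Q (a ↑ˡ k)) + count k (λ b → Q (m ↑ʳ b))
count-+ zero    k Q = refl
count-+ (suc m) k Q = trans (cong (bit (Q zero) +_) (count-+ m k (Q ∘ suc))) (sym (+-assoc (bit (Q zero)) _ _))

count-joinΣ : ∀ k (x : Fin k → ℕ) (Q : Fin (Σ[< k ] x) → Bool) →
              count (Σ[< k ] x) Q ≡ Σ[< k ] (λ i → count (x i) (λ a → Q (joinΣ k x (i , a))))
count-joinΣ zero    x Q = refl
count-joinΣ (suc k) x Q =
  trans (count-+ (x zero) _ Q)
        (cong (count (x zero) (λ a → Q (a ↑ˡ _)) +_) (count-joinΣ k (x ∘ suc) (λ r → Q (x zero ↑ʳ r))))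

count-splitΣ : ∀ k (x : Fin k → ℕ) (Q : Σ (Fin k) (Fin ∘ x) → Bool) →
               count (Σ[< k ] x) (Q ∘ splitΣ k x) ≡ Σ[< k ] (λ i → count (x i) (λ a → Q (i , a)))
count-splitΣ k x Q = trans (count-joinΣ k x _)
  (Σ-cong k (λ i → count-cong (x i) (λ a → cong Q (splitΣ-joinΣ k x (i , a)))))

count-splitΣ-part : ∀ k (x : Fin k → ℕ) (Q : Σ (Fin k) (Fin ∘ x) → Bool) i →
                    count (Σ[< k ] x) (λ z → Q (splitΣ k x z) ∧ does (proj₁ (splitΣ k x z) Fin.≟ i)) ≡
                    count (x i) (λ a → Q (i , a))
count-splitΣ-part k x Q i = begin
  count (Σ[< k ] x) (λ z → Q (splitΣ k x z) ∧ does (proj₁ (splitΣ k x z) Fin.≟ i))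
    ≡⟨ count-splitΣ k x (λ q → Q q ∧ does (proj₁ q Fin.≟ i)) ⟩
  Σ[< k ] (λ j → count (x j) (λ a → Q (j , a) ∧ does (j Fin.≟ i)))
    ≡⟨ Σ-single k _ i (λ j j≢i → count-none (x j) _ λ a →
         trans (cong (Q (j , a) ∧_) (dec-false (j Fin.≟ i) j≢i)) (∧-zeroʳ _)) ⟩
  count (x i) (λ a → Q (i , a) ∧ does (i Fin.≟ i))
    ≡⟨ count-cong (x i) (λ a → trans (cong (Q (i , a) ∧_) (dec-true (i Fin.≟ i) refl)) (∧-identityʳ _)) ⟩
  count (x i) (λ a → Q (i , a)) ∎
  where open ≡-Reasoning

-- Ranking and monotone sequences

injective⇒surjective : ∀ k (f : Fin k → Fin k) → Injective _≡_ _≡_ f → ∀ j → ∃ λ i → f i ≡ j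
injective⇒surjective zero    f f-inj ()
injective⇒surjective (suc k) f f-inj j with Finₚ.any? (λ i → f i Fin.≟ j)
... | yes hit = hit
... | no miss = contradiction (Finₚ.injective⇒≤ f′-inj) (<-irrefl refl)
  where
  f′ : Fin (suc k) → Fin k
  f′ i = Fin.punchOut {i = j} (λ eq → miss (i , sym eq))
  f′-inj : Injective _≡_ _≡_ f′
  f′-inj {a} {b} = f-inj ∘ Finₚ.punchOut-injective {i = j} (λ eq → miss (a , sym eq)) (λ eq → miss (b , sym eq))

injective⇒permutation : ∀ {k} (f : Fin k → Fin k) → Injective _≡_ _≡_ f → Permutation′ k
injective⇒permutation {k} f f-inj = permutation f f⁻¹ (proj₂ ∘ surj) (λ i → f-inj (proj₂ (surj (f i))))
  where
  surj = injective⇒surjective k f f-inj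
  f⁻¹ : Fin k → Fin k
  f⁻¹ = proj₁ ∘ surj

module Ranking {k} (key : Fin k → ℕ) (key-injective : Injective _≡_ _≡_ key) where

  rankℕ : Fin k → ℕ
  rankℕ z = count k (λ z′ → does (key z′ <? key z))

  rankℕ-mono : ∀ {a b} → key a < key b → rankℕ a < rankℕ b
  rankℕ-mono {a} {b} ka<kb = count-mono-< k
    (λ z h → dec-true (key z <? key b) (<-trans (dec-true⁻¹ (key z <? key a) h) ka<kb))
    a (dec-false (key a <? key a) (<-irrefl refl)) (dec-true (key a <? key b) ka<kb)

  rankℕ<k : ∀ z → rankℕ z < k
  rankℕ<k z = <-≤-trans
    (count-mono-< k (λ _ _ → refl) z (dec-false (key z <? key z) (<-irrefl refl)) refl)
    (≤-reflexive (count-all k _ λ _ → refl))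

  rankℕ-injective : Injective _≡_ _≡_ rankℕ
  rankℕ-injective {a} {b} eq with <-cmp (key a) (key b)
  ... | tri< lt _ _ = contradiction eq (<⇒≢ (rankℕ-mono lt))
  ... | tri≈ _ e _  = key-injective e
  ... | tri> _ _ gt = contradiction (sym eq) (<⇒≢ (rankℕ-mono gt))

  rank : Fin k → Fin k
  rank z = fromℕ< (rankℕ<k z)

  toℕ-rank : ∀ z → toℕ (rank z) ≡ rankℕ z
  toℕ-rank z = toℕ-fromℕ< (rankℕ<k z)

  rank-injective : Injective _≡_ _≡_ rank
  rank-injective {a} {b} eq = rankℕ-injective (trans (sym (toℕ-rank a)) (trans (cong toℕ eq) (toℕ-rank b)))

  rankPermutation : Permutation′ k
  rankPermutation = injective⇒permutation rank rank-injective

module _ {k} (D : Fin k → ℕ) where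

  tiebreak : Fin k → ℕ
  tiebreak z = D z * k + toℕ z

  tiebreak-mono : ∀ {a b} → D a < D b → tiebreak a < tiebreak b
  tiebreak-mono {a} {b} Da<Db = begin-strict
    D a * k + toℕ a  <⟨ +-monoʳ-< (D a * k) (toℕ<n a) ⟩
    D a * k + k      ≡⟨ +-comm (D a * k) k ⟩
    suc (D a) * k    ≤⟨ *-monoˡ-≤ k Da<Db ⟩
    D b * k          ≤⟨ m≤m+n (D b * k) (toℕ b) ⟩
    D b * k + toℕ b  ∎
    where open ≤-Reasoning

  tiebreak-injective : Injective _≡_ _≡_ tiebreak
  tiebreak-injective {a} {b} eq with <-cmp (D a) (D b)
  ... | tri< lt _ _ = contradiction eq (<⇒≢ (tiebreak-mono lt))
  ... | tri≈ _ e _ = toℕ-injective (+-cancelˡ-≡ (D a * k) _ _ (trans eq (cong (λ d → d * k + toℕ b) (sym e))))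
  ... | tri> _ _ gt = contradiction (sym eq) (<⇒≢ (tiebreak-mono gt))

  tiebreak<⇒≤ : ∀ {a b} → tiebreak a < tiebreak b → D a ≤ D b
  tiebreak<⇒≤ lt = ≮⇒≥ (λ Db<Da → <-asym lt (tiebreak-mono Db<Da))

Monotone : ∀ {m} → (Fin m → ℕ) → Set
Monotone {m} f = ∀ a b → toℕ a ≤ toℕ b → f a ≤ f b

count-downClosed : ∀ m (P : Fin m → Bool) → (∀ a b → toℕ a ≤ toℕ b → P b ≡ true → P a ≡ true) →
                   ∀ a → P a ≡ true ⇔ toℕ a < count m P
count-downClosed (suc m) P closed a with P zero in P0
... | false = mk⇔ (λ Pa → contradiction (trans (sym (closed zero a z≤n Pa)) P0) λ ())
                  (λ a<0 → contradiction (≤-trans a<0 (≤-reflexive none)) λ ())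
  where
  none : count m (P ∘ suc) ≡ 0
  none = count-none m (P ∘ suc) (λ b → ¬-not (λ Pb → contradiction (trans (sym (closed zero (suc b) z≤n Pb)) P0) λ ()))
... | true with a
...   | zero  = mk⇔ (λ _ → s≤s z≤n) (λ _ → P0)
...   | suc b = mk⇔ (s≤s ∘ to) (from ∘ s<s⁻¹)
  where open Equivalence (count-downClosed m (P ∘ suc) (λ x y x≤y → closed (suc x) (suc y) (s≤s x≤y)) b)

-- For monotone f, f a < x iff a lies below the number of b with f b < x, and that number is the same for g.
monotone-permutation-unique : ∀ m (f g : Fin m → ℕ) (π : Permutation′ m) → Monotone f → Monotone g →
                              (∀ a → f a ≡ g (π ⟨$⟩ʳ a)) → ∀ a → f a ≡ g a
monotone-permutation-unique m f g π f-mono g-mono f≡g∘π a =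
  ≤-antisym (s≤s⁻¹ (g<⇒f< (suc (g a)) ≤-refl)) (s≤s⁻¹ (f<⇒g< (suc (f a)) ≤-refl))
  where
  below : (Fin m → ℕ) → ℕ → ℕ
  below h x = count m (λ b → does (h b <? x))

  same-below : ∀ x → below f x ≡ below g x
  same-below x = trans (count-cong m (λ b → cong (λ y → does (y <? x)) (f≡g∘π b)))
                       (count-permute m (λ b → does (g b <? x)) π)

  module Below (h : Fin m → ℕ) (h-mono : Monotone h) (x : ℕ) where
    open Equivalence (count-downClosed m (λ b → does (h b <? x))
      (λ b b′ b≤b′ h<x → dec-true (h b <? x) (≤-<-trans (h-mono b b′ b≤b′) (dec-true⁻¹ (h b′ <? x) h<x))) a)
      public

  f<⇒g< : ∀ x → f a < x → g a < x
  f<⇒g< x fa<x = dec-true⁻¹ (g a <? x)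
    (Below.from g g-mono x (subst (toℕ a <_) (same-below x) (Below.to f f-mono x (dec-true (f a <? x) fa<x))))

  g<⇒f< : ∀ x → g a < x → f a < x
  g<⇒f< x ga<x = dec-true⁻¹ (f a <? x)
    (Below.from f f-mono x (subst (toℕ a <_) (sym (same-below x)) (Below.to g g-mono x (dec-true (g a <? x) ga<x))))

-- Words and their multinomial count

module _ {M : ℕ} where

  occurrences : ∀ {S} → Vec (Fin M) S → Fin M → ℕ
  occurrences []      i = 0
  occurrences (a ∷ w) i = bit (does (a Fin.≟ i)) + occurrences w i

  before : ∀ {S} → Vec (Fin M) S → Fin M → ℕ → ℕ
  before []      i t       = 0
  before (a ∷ w) i zero    = 0
  before (a ∷ w) i (suc t) = bit (does (a Fin.≟ i)) + before w i t

  -- position w i k is the index in w of the k-th occurrence (counting from 0) of i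
  position : ∀ {S} → Vec (Fin M) S → Fin M → ℕ → ℕ
  position []      i k = 0
  position (a ∷ w) i k with a Fin.≟ i | k
  ... | yes _ | zero  = 0
  ... | yes _ | suc k = suc (position w i k)
  ... | no _  | k     = suc (position w i k)

  position-lookup : ∀ {S} (w : Vec (Fin M) S) i k → k < occurrences w i →
                   ∃ λ (t : Fin S) → toℕ t ≡ position w i k × lookup w t ≡ i
  position-lookup (a ∷ w) i k lt with a Fin.≟ i
  position-lookup (a ∷ w) i zero    lt | yes a≡i = zero , refl , a≡i
  position-lookup (a ∷ w) i (suc k) lt | yes _ with position-lookup w i k (s<s⁻¹ lt)
  ... | t , eq , at = suc t , cong suc eq , at
  position-lookup (a ∷ w) i k       lt | no _ with position-lookup w i k lt
  ... | t , eq , at = suc t , cong suc eq , at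

  position-mono : ∀ {S} (w : Vec (Fin M) S) i {k k′} → k < k′ → k′ < occurrences w i →
                  position w i k < position w i k′
  position-mono (a ∷ w) i {k} {k′} lt lt′ with a Fin.≟ i | k | k′
  ... | yes _ | zero  | suc _  = s≤s z≤n
  ... | yes _ | suc k | suc k′ = s≤s (position-mono w i (s<s⁻¹ lt) (s<s⁻¹ lt′))
  ... | no _  | k     | k′     = s≤s (position-mono w i lt lt′)

  position-before : ∀ {S} (w : Vec (Fin M) S) (t : Fin S) →
                    position w (lookup w t) (before w (lookup w t) (toℕ t)) ≡ toℕ t
  position-before (a ∷ w) zero    with a Fin.≟ a
  ... | yes _  = refl
  ... | no a≢a = contradiction refl a≢a
  position-before (a ∷ w) (suc t) with a Fin.≟ lookup w t
  ... | yes _ = cong suc (position-before w t)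
  ... | no _  = cong suc (position-before w t)

  before≤occurrences : ∀ {S} (w : Vec (Fin M) S) i t → before w i t ≤ occurrences w i
  before≤occurrences []      i t       = z≤n
  before≤occurrences (a ∷ w) i zero    = z≤n
  before≤occurrences (a ∷ w) i (suc t) = +-monoʳ-≤ (bit (does (a Fin.≟ i))) (before≤occurrences w i t)

  before<occurrences : ∀ {S} (w : Vec (Fin M) S) (t : Fin S) →
                       before w (lookup w t) (toℕ t) < occurrences w (lookup w t)
  before<occurrences (a ∷ w) zero    with a Fin.≟ a
  ... | yes _  = s≤s z≤n
  ... | no a≢a = contradiction refl a≢a
  before<occurrences (a ∷ w) (suc t) with a Fin.≟ lookup w t
  ... | yes _ = s≤s (before<occurrences w t)
  ... | no _  = before<occurrences w t

  before-length : ∀ {S} (w : Vec (Fin M) S) i → before w i S ≡ occurrences w i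
  before-length []      i = refl
  before-length (a ∷ w) i = cong (bit (does (a Fin.≟ i)) +_) (before-length w i)

  position<⇒<before : ∀ {S} (w : Vec (Fin M) S) i l t → l < occurrences w i →
                      position w i l < t → l < before w i t
  position<⇒<before (a ∷ w) i l       (suc t) l<occ lt with a Fin.≟ i | l
  ... | yes _ | zero  = s≤s z≤n
  ... | yes _ | suc l = s≤s (position<⇒<before w i l t (s<s⁻¹ l<occ) (s<s⁻¹ lt))
  ... | no _  | l     = position<⇒<before w i l t l<occ (s<s⁻¹ lt)

  <before⇒position< : ∀ {S} (w : Vec (Fin M) S) i l t → l < before w i t → position w i l < t
  <before⇒position< (a ∷ w) i l       (suc t) lt with a Fin.≟ i | l
  ... | yes _ | zero  = s≤s z≤n
  ... | yes _ | suc l = s≤s (<before⇒position< w i l t (s<s⁻¹ lt))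
  ... | no _  | l     = s≤s (<before⇒position< w i l t lt)

  Σ-bit≟ : (a : Fin M) → Σ[< M ] (λ j → bit (does (a Fin.≟ j))) ≡ 1
  Σ-bit≟ a = trans (Σ-single M _ a (λ j j≢a → cong bit (dec-false (a Fin.≟ j) (j≢a ∘ sym))))
                   (cong bit (dec-true (a Fin.≟ a) refl))

  Σ-before : ∀ {S} (w : Vec (Fin M) S) t → t ≤ S → Σ[< M ] (λ j → before w j t) ≡ t
  Σ-before []      zero    _  = Σ-zero M
  Σ-before (a ∷ w) zero    _  = Σ-zero M
  Σ-before (a ∷ w) (suc t) le = trans (Σ-distrib-+ M (λ j → bit (does (a Fin.≟ j))) (λ j → before w j t))
                                      (cong₂ _+_ (Σ-bit≟ a) (Σ-before w t (≤-pred le)))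

  count-position< : ∀ {S} (w : Vec (Fin M) S) i m → occurrences w i ≡ m → ∀ t →
                    count m (λ l → does (position w i (toℕ l) <? t)) ≡ before w i t
  count-position< w i m occ≡m t = trans (count-cong m same)
    (count-toℕ< m (before w i t) (subst (before w i t ≤_) occ≡m (before≤occurrences w i t)))
    where
    same : (l : Fin m) → does (position w i (toℕ l) <? t) ≡ does (toℕ l <? before w i t)
    same l = <?-cong (mk⇔ (position<⇒<before w i (toℕ l) t (subst (toℕ l <_) (sym occ≡m) (toℕ<n l)))
                          (<before⇒position< w i (toℕ l) t))

  HasCounts : ∀ {S} → Vec (Fin M) S → (Fin M → ℕ) → Set
  HasCounts w c = ∀ j → occurrences w j ≡ c j

  counts-tail : ∀ {S} {c : Fin M → ℕ} a (w : Vec (Fin M) S) → HasCounts (a ∷ w) c → HasCounts w (updateAt c a pred)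
  counts-tail {c = c} a w a∷w∈c j with a Fin.≟ j | a∷w∈c j
  ... | yes refl | eq = trans (cong pred eq) (sym (updateAt-updates a c))
  ... | no a≢j   | eq = trans eq (sym (updateAt-minimal j a c (a≢j ∘ sym)))

  counts-head-positive : ∀ {S} {c : Fin M → ℕ} a (w : Vec (Fin M) S) → HasCounts (a ∷ w) c → 0 < c a
  counts-head-positive a w a∷w∈c with a Fin.≟ a | a∷w∈c a
  ... | yes _  | eq = subst (0 <_) eq (s≤s z≤n)
  ... | no a≢a | _  = contradiction refl a≢a

  counts-cons : ∀ {S} {c : Fin M → ℕ} a (w : Vec (Fin M) S) {m} → c a ≡ suc m →
                HasCounts w (updateAt c a pred) → HasCounts (a ∷ w) c
  counts-cons {c = c} a w {m} ca≡1+m w∈c′ j with a Fin.≟ j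
  ... | yes refl = begin
    suc (occurrences w a)         ≡⟨ cong suc (w∈c′ a) ⟩
    suc (updateAt c a pred a)     ≡⟨ cong suc (updateAt-updates a c) ⟩
    suc (pred (c a))              ≡⟨ cong (λ x → suc (pred x)) ca≡1+m ⟩
    suc m                         ≡⟨ ca≡1+m ⟨
    c a                           ∎
    where open ≡-Reasoning
  ... | no a≢j = trans (w∈c′ j) (updateAt-minimal j a c (a≢j ∘ sym))

  module _ {S} (w : Vec (Fin M) S) {c : Fin M → ℕ} (w∈c : HasCounts w c) where

    Σ-count-position< : ∀ t → t ≤ S → Σ[< M ] (λ j → count (c j) (λ l → does (position w j (toℕ l) <? t))) ≡ t
    Σ-count-position< t le = trans (Σ-cong M (λ j → count-position< w j (c j) (w∈c j) t)) (Σ-before w t le)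

    position-lookup′ : ∀ i (a : Fin (c i)) → ∃ λ (t : Fin S) → toℕ t ≡ position w i (toℕ a) × lookup w t ≡ i
    position-lookup′ i a = position-lookup w i (toℕ a) (subst (toℕ a <_) (sym (w∈c i)) (toℕ<n a))

    position<length : ∀ i (a : Fin (c i)) → position w i (toℕ a) < S
    position<length i a with position-lookup′ i a
    ... | t , eq , _ = subst (_< S) eq (toℕ<n t)

    position-injectiveˡ : ∀ i j (a : Fin (c i)) (b : Fin (c j)) → position w i (toℕ a) ≡ position w j (toℕ b) → i ≡ j
    position-injectiveˡ i j a b eq with position-lookup′ i a | position-lookup′ j b
    ... | t , eqt , wt≡i | t′ , eqt′ , wt′≡j =
      trans (sym wt≡i) (trans (cong (lookup w) (toℕ-injective (trans eqt (trans eq (sym eqt′))))) wt′≡j)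

    position-mono-≤ : ∀ i (a b : Fin (c i)) → toℕ a ≤ toℕ b → position w i (toℕ a) ≤ position w i (toℕ b)
    position-mono-≤ i a b a≤b with m≤n⇒m<n∨m≡n a≤b
    ... | inj₁ a<b = <⇒≤ (position-mono w i a<b (subst (toℕ b <_) (sym (w∈c i)) (toℕ<n b)))
    ... | inj₂ a≡b = ≤-reflexive (cong (position w i) a≡b)

    position<⇔< : ∀ i (a b : Fin (c i)) → position w i (toℕ a) < position w i (toℕ b) ⇔ toℕ a < toℕ b
    position<⇔< i a b = mk⇔ (λ lt → ≰⇒> (λ b≤a → <⇒≱ lt (position-mono-≤ i b a b≤a)))
                           (λ a<b → position-mono w i a<b (subst (toℕ b <_) (sym (w∈c i)) (toℕ<n b)))

  position-ext : ∀ {S} (w w′ : Vec (Fin M) S) → (∀ j → occurrences w j ≡ occurrences w′ j) →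
                 (∀ i k → k < occurrences w i → position w i k ≡ position w′ i k) → w ≡ w′
  position-ext {S} w w′ same-counts same-positions =
    trans (sym (tabulate∘lookup w)) (trans (tabulate-cong same-letter) (tabulate∘lookup w′))
    where
    same-letter : (t : Fin S) → lookup w t ≡ lookup w′ t
    same-letter t with position-lookup w′ (lookup w t) (before w (lookup w t) (toℕ t))
                         (subst (_ <_) (same-counts (lookup w t)) (before<occurrences w t))
    ... | t′ , eq , w′t′ = trans (sym w′t′) (cong (lookup w′) (toℕ-injective (begin
      toℕ t′                                                 ≡⟨ eq ⟩
      position w′ (lookup w t) (before w (lookup w t) (toℕ t)) ≡⟨ same-positions _ _ (before<occurrences w t) ⟨
      position w (lookup w t) (before w (lookup w t) (toℕ t))  ≡⟨ position-before w t ⟩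
      toℕ t                                                  ∎)))
      where open ≡-Reasoning

  before-tabulate : ∀ S (g : Fin S → Fin M) i t →
                    before (tabulate g) i t ≡ count S (λ s → does (toℕ s <? t) ∧ does (g s Fin.≟ i))
  before-tabulate zero    g i t       = refl
  before-tabulate (suc S) g i zero    = sym (count-none (suc S) _ (λ _ → refl))
  before-tabulate (suc S) g i (suc t) = cong (bit (does (g zero Fin.≟ i)) +_) (before-tabulate S (g ∘ suc) i t)

ifPositive : ℕ → ℕ → ℕ
ifPositive zero    _ = 0
ifPositive (suc _) x = x

ifPositive-lower : ∀ m x → Fin (ifPositive m x) → Fin x
ifPositive-lower (suc _) x k = k

ifPositive-raise : ∀ m x → .(0 < m) → Fin x → Fin (ifPositive m x)
ifPositive-raise (suc _) x _ k = k

ifPositive-positive : ∀ m x → Fin (ifPositive m x) → ∃ λ m′ → m ≡ suc m′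
ifPositive-positive (suc m′) x _ = m′ , refl

ifPositive-lower-raise : ∀ m x .(0<m : 0 < m) k → ifPositive-lower m x (ifPositive-raise m x 0<m k) ≡ k
ifPositive-lower-raise (suc _) x _ k = refl

ifPositive-raise-lower : ∀ m x .(0<m : 0 < m) k → ifPositive-raise m x 0<m (ifPositive-lower m x k) ≡ k
ifPositive-raise-lower (suc _) x _ k = refl

Σ-updateAt-pred : ∀ k (f : Fin k → ℕ) i {m} → f i ≡ suc m → Σ[< k ] f ≡ suc (Σ[< k ] (updateAt f i pred))
Σ-updateAt-pred (suc k) f zero    fi≡1+m rewrite fi≡1+m = refl
Σ-updateAt-pred (suc k) f (suc i) fi≡1+m =
  trans (cong (f zero +_) (Σ-updateAt-pred k (f ∘ suc) i fi≡1+m)) (+-suc (f zero) _)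

∏!-updateAt-pred : ∀ k (f : Fin k → ℕ) i {m} → f i ≡ suc m →
                   ∏[< k ] (λ j → f j !) ≡ f i * ∏[< k ] (λ j → updateAt f i pred j !)
∏!-updateAt-pred (suc k) f zero {m} fi≡1+m rewrite fi≡1+m = *-assoc (suc m) (m !) _
∏!-updateAt-pred (suc k) f (suc i) fi≡1+m = begin
  f zero ! * ∏[< k ] (λ j → f (suc j) !)
    ≡⟨ cong (f zero ! *_) (∏!-updateAt-pred k (f ∘ suc) i fi≡1+m) ⟩
  f zero ! * (f (suc i) * ∏[< k ] (λ j → updateAt (f ∘ suc) i pred j !))
    ≡⟨ x∙yz≈y∙xz (f zero !) (f (suc i)) _ ⟩
  f (suc i) * (f zero ! * ∏[< k ] (λ j → updateAt (f ∘ suc) i pred j !)) ∎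
  where open ≡-Reasoning

∏!-zeros : ∀ k (c : Fin k → ℕ) → (∀ j → c j ≡ 0) → ∏[< k ] (λ j → c j !) ≡ 1
∏!-zeros zero    c _     = refl
∏!-zeros (suc k) c zeros rewrite zeros zero = trans (+-identityʳ _) (∏!-zeros k (c ∘ suc) (zeros ∘ suc))

module _ {M : ℕ} where

  -- Words with multiplicities c, split by their first letter.  This counts them only when Σ c ≡ S:
  -- wordCount 0 c = 1 for every c.
  mutual
    wordCount : ℕ → (Fin M → ℕ) → ℕ
    wordCount zero    c = 1
    wordCount (suc S) c = Σ[< M ] (startingWith S c)

    startingWith : ℕ → (Fin M → ℕ) → Fin M → ℕ
    startingWith S c i = ifPositive (c i) (wordCount S (updateAt c i pred))

  mutual
    decode : ∀ S c → Fin (wordCount S c) → Vec (Fin M) S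
    decode zero    c _ = []
    decode (suc S) c z = decodeCons S c (splitΣ M (startingWith S c) z)

    decodeCons : ∀ S c → Σ (Fin M) (Fin ∘ startingWith S c) → Vec (Fin M) (suc S)
    decodeCons S c (i , k) = i ∷ decode S (updateAt c i pred) (ifPositive-lower (c i) _ k)

  encode : ∀ S c (w : Vec (Fin M) S) → .(HasCounts w c) → Fin (wordCount S c)
  encode zero    c []      _     = zero
  encode (suc S) c (a ∷ w) a∷w∈c = joinΣ M (startingWith S c)
    (a , ifPositive-raise (c a) _ (counts-head-positive a w a∷w∈c) (encode S (updateAt c a pred) w (counts-tail a w a∷w∈c)))

  decode-encode : ∀ S c (w : Vec (Fin M) S) .(w∈c : HasCounts w c) → decode S c (encode S c w w∈c) ≡ w
  decode-encode zero    c []      _     = refl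
  decode-encode (suc S) c (a ∷ w) a∷w∈c = begin
    decodeCons S c (splitΣ M _ (joinΣ M _ (a , raised)))
      ≡⟨ cong (decodeCons S c) (splitΣ-joinΣ M _ (a , raised)) ⟩
    a ∷ decode S (updateAt c a pred) (ifPositive-lower (c a) _ raised)
      ≡⟨ cong (λ k → a ∷ decode S (updateAt c a pred) k) (ifPositive-lower-raise (c a) _ _ _) ⟩
    a ∷ decode S (updateAt c a pred) (encode S (updateAt c a pred) w _)
      ≡⟨ cong (a ∷_) (decode-encode S (updateAt c a pred) w (counts-tail a w a∷w∈c)) ⟩
    a ∷ w ∎
    where
    open ≡-Reasoning
    raised = ifPositive-raise (c a) _ (counts-head-positive a w a∷w∈c)
               (encode S (updateAt c a pred) w (counts-tail a w a∷w∈c))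

  encode-decode : ∀ S c (z : Fin (wordCount S c)) .(w∈c : HasCounts (decode S c z) c) → encode S c (decode S c z) w∈c ≡ z
  encode-decode zero    c zero _ = refl
  encode-decode (suc S) c z w∈c = trans (encode-decodeCons (splitΣ M _ z) w∈c) (joinΣ-splitΣ M _ z)
    where
    encode-decodeCons : ∀ q .(w∈c : HasCounts (decodeCons S c q) c) → encode (suc S) c (decodeCons S c q) w∈c ≡ joinΣ M _ q
    encode-decodeCons (i , k) w∈c = cong (λ k′ → joinΣ M _ (i , k′)) (begin
      ifPositive-raise (c i) _ _ (encode S _ (decode S _ (ifPositive-lower (c i) _ k)) _)
        ≡⟨ cong (ifPositive-raise (c i) _ _) (encode-decode S _ (ifPositive-lower (c i) _ k) _) ⟩
      ifPositive-raise (c i) _ _ (ifPositive-lower (c i) _ k)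
        ≡⟨ ifPositive-raise-lower (c i) _ _ k ⟩
      k ∎)
      where open ≡-Reasoning

  decode-counts : ∀ S c → Σ[< M ] c ≡ S → ∀ z → HasCounts (decode S c z) c
  decode-counts zero    c Σc≡0 z j = sym (Σ≡0⇒≡0 M c Σc≡0 j)
  decode-counts (suc S) c Σc≡S z = decodeCons-counts (splitΣ M _ z)
    where
    decodeCons-counts : ∀ q → HasCounts (decodeCons S c q) c
    decodeCons-counts (i , k) with ifPositive-positive (c i) _ k
    ... | m , ci≡1+m = counts-cons i (decode S _ (ifPositive-lower (c i) _ k)) ci≡1+m (decode-counts S (updateAt c i pred)
            (suc-injective (trans (sym (Σ-updateAt-pred M c i ci≡1+m)) Σc≡S)) _)

  wordCount-*-∏! : ∀ S c → Σ[< M ] c ≡ S → wordCount S c * ∏[< M ] (λ j → c j !) ≡ S !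
  wordCount-*-∏! zero    c Σc≡0 = trans (+-identityʳ _) (∏!-zeros M c (Σ≡0⇒≡0 M c Σc≡0))
  wordCount-*-∏! (suc S) c Σc≡1+S = begin
    Σ[< M ] (startingWith S c) * P c          ≡⟨ Σ-distribʳ-* M _ (P c) ⟨
    Σ[< M ] (λ i → startingWith S c i * P c)  ≡⟨ Σ-cong M term ⟩
    Σ[< M ] (λ i → c i * S !)                 ≡⟨ Σ-distribʳ-* M c (S !) ⟩
    Σ[< M ] c * S !                           ≡⟨ cong (_* S !) Σc≡1+S ⟩
    suc S !                                   ∎
    where
    open ≡-Reasoning
    P : (Fin M → ℕ) → ℕ
    P c = ∏[< M ] (λ j → c j !)
    term : ∀ i → startingWith S c i * P c ≡ c i * S !
    term i with c i in ci≡
    ... | zero  = refl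
    ... | suc m = begin
      W * P c                      ≡⟨ cong (W *_) (∏!-updateAt-pred M c i ci≡) ⟩
      W * (c i * P c′)             ≡⟨ x∙yz≈y∙xz W (c i) (P c′) ⟩
      c i * (W * P c′)             ≡⟨ cong₂ _*_ ci≡ (wordCount-*-∏! S c′ Σc′≡S) ⟩
      suc m * S !                  ∎
      where
      c′ = updateAt c i pred
      W = wordCount S c′
      Σc′≡S = suc-injective (trans (sym (Σ-updateAt-pred M c i ci≡)) Σc≡1+S)

  multinomial≡wordCount : (c : Fin M → ℕ) → multinomial M c ≡ wordCount (Σ[< M ] c) c
  multinomial≡wordCount c = begin
    ((Σ[< M ] c) ! / P) {{∏!≢0 M c}}        ≡⟨ cong (λ x → (x / P) {{∏!≢0 M c}}) (wordCount-*-∏! _ c refl) ⟨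
    ((W * P) / P) {{∏!≢0 M c}}              ≡⟨ m*n/n≡m W P {{∏!≢0 M c}} ⟩
    W                                       ∎
    where
    open ≡-Reasoning
    P = ∏[< M ] (λ j → c j !)
    W = wordCount (Σ[< M ] c) c

-- Orientations given by heights

odd<odd⇔< : ∀ a b → suc (2 * a) < suc (2 * b) ⇔ a < b
odd<odd⇔< a b = mk⇔ (*-cancelˡ-< 2 a b ∘ s<s⁻¹) (s≤s ∘ *-monoʳ-< 2)

odd<even⇔< : ∀ a b → suc (2 * a) < 2 * b ⇔ a < b
odd<even⇔< a b = mk⇔ (λ lt → *-cancelˡ-< 2 a b (<-trans (n<1+n _) lt))
                     (λ a<b → subst (_≤ 2 * b) (*-suc 2 a) (*-monoʳ-≤ 2 a<b))

even<odd⇔≤ : ∀ a b → 2 * a < suc (2 * b) ⇔ a ≤ b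
even<odd⇔≤ a b = mk⇔ (*-cancelˡ-≤ 2 ∘ s≤s⁻¹) (s≤s ∘ *-monoʳ-≤ 2)

module _ {A : Set} (_⇒_ : A → A → Set) (h : A → ℕ) (h-mono : ∀ {u v} → u ⇒ v → h u < h v) where

  height-mono⁺ : ∀ {u v} → TransClosure _⇒_ u v → h u < h v
  height-mono⁺ [ u⇒v ]      = h-mono u⇒v
  height-mono⁺ (u⇒w ∷ w⇒⁺v) = <-trans (h-mono u⇒w) (height-mono⁺ w⇒⁺v)

  height⇒acyclic : ∀ v → ¬ TransClosure _⇒_ v v
  height⇒acyclic v cycle = <-irrefl refl (height-mono⁺ cycle)

module Upward {M n} (h : Vertex M n → ℕ) where

  upward : Vertex M n → Vertex M n → Bool
  upward u v = not (does (proj₁ u Fin.≟ proj₁ v)) ∧ does (h u <? h v)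

  upward-isOrientation : (∀ u v → Adj u v → h u ≢ h v) → IsOrientation upward
  upward-isOrientation h-injective u v = same-part , different-parts
    where
    same-part : proj₁ u ≡ proj₁ v → upward u v ≡ false
    same-part eq rewrite dec-true (proj₁ u Fin.≟ proj₁ v) eq = refl
    different-parts : Adj u v → upward u v ≡ not (upward v u)
    different-parts u≢v
      rewrite dec-false (proj₁ u Fin.≟ proj₁ v) u≢v | dec-false (proj₁ v Fin.≟ proj₁ u) (u≢v ∘ sym)
      with <-cmp (h u) (h v)
    ... | tri< lt _ _ rewrite dec-true (h u <? h v) lt | dec-false (h v <? h u) (<-asym lt) = refl
    ... | tri≈ _ eq _ = contradiction eq (h-injective u v u≢v)
    ... | tri> _ _ gt rewrite dec-false (h u <? h v) (<-asym gt) | dec-true (h v <? h u) gt = refl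

  upward-mono : ∀ {u v} → upward u v ≡ true → h u < h v
  upward-mono {u} {v} eq with does (proj₁ u Fin.≟ proj₁ v)
  ... | false = dec-true⁻¹ (h u <? h v) eq

  upward-≤ : ∀ v {i} {a b} → h (i , a) ≤ h (i , b) → upward v (i , a) ≡ true → upward v (i , b) ≡ true
  upward-≤ v {i} {a} {b} h≤ eq with does (proj₁ v Fin.≟ i)
  ... | false = dec-true (h v <? h (i , b)) (<-≤-trans (dec-true⁻¹ (h v <? h (i , a)) eq) h≤)

  upward-acyclic : Acyclic upward
  upward-acyclic = height⇒acyclic _ h upward-mono

  -- Both are orientations, so it suffices that every edge of o goes up.
  upward-unique : ∀ (o : Vertex M n → Vertex M n → Bool) → IsOrientation o →
                  (∀ u v → o u v ≡ true → h u < h v) → ∀ u v → o u v ≡ upward u v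
  upward-unique o o-orientation o-mono u v with proj₁ u Fin.≟ proj₁ v
  ... | yes eq = proj₁ (o-orientation u v) eq
  ... | no u≢v with o u v in ouv
  ...   | true  = sym (dec-true (h u <? h v) (o-mono u v ouv))
  ...   | false = sym (dec-false (h u <? h v) (<⇒≱ (o-mono v u vu) ∘ <⇒≤))
    where
    vu : o v u ≡ true
    vu = trans (proj₂ (o-orientation v u) (u≢v ∘ sym)) (cong not ouv)

upward-cong : ∀ {M n} {h h′ : Vertex M n → ℕ} → (∀ u → h u ≡ h′ u) →
              ∀ u v → Upward.upward h u v ≡ Upward.upward h′ u v
upward-cong h≗h′ u v = cong₂ (λ x y → not (does (proj₁ u Fin.≟ proj₁ v)) ∧ does (x <? y)) (h≗h′ u) (h≗h′ v)

upward-act : ∀ {M n} (h : Vertex M n → ℕ) π u v → Upward.upward h (act π u) (act π v) ≡ Upward.upward (h ∘ act π) u v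
upward-act h π (zero  , a) (zero  , b) = refl
upward-act h π (zero  , a) (suc j , b) = refl
upward-act h π (suc i , a) (zero  , b) = refl
upward-act h π (suc i , a) (suc j , b) = refl

-- The action of Sym(V₂) × ⋯ × Sym(V_N)

module Parts {M : ℕ} {n : Fin (suc M) → ℕ} where

  c : Fin M → ℕ
  c i = n (suc i)

  S : ℕ
  S = Σ[< M ] c

  part : Fin S → Fin M
  part z = proj₁ (splitΣ M c z)

  inner : Fin S → Vertex M n
  inner z = suc (part z) , proj₂ (splitΣ M c z)

  inner-joinΣ : ∀ i a → inner (joinΣ M c (i , a)) ≡ (suc i , a)
  inner-joinΣ i a = cong (λ q → suc (proj₁ q) , proj₂ q) (splitΣ-joinΣ M c (i , a))

  countInner : (Vertex M n → Bool) → ℕ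
  countInner P = count S (P ∘ inner)

  countInner-parts : ∀ P → countInner P ≡ Σ[< M ] (λ i → count (c i) (λ a → P (suc i , a)))
  countInner-parts P = count-splitΣ M c (λ q → P (suc (proj₁ q) , proj₂ q))

  infixr 5 _·_
  _·_ : PartPerm M n → Vertex M n → Vertex M n
  π · u = act π u

  inverse : PartPerm M n → PartPerm M n
  inverse π i = Perm.flip (π i)

  act-inverse : ∀ π u → π · inverse π · u ≡ u
  act-inverse π (zero  , a) = refl
  act-inverse π (suc i , a) = cong (suc i ,_) (inverseʳ (π i))

  move : PartPerm M n → Fin S → Fin S
  move π z = joinΣ M c (part z , π (part z) ⟨$⟩ʳ proj₂ (splitΣ M c z))

  inner-move : ∀ π z → inner (move π z) ≡ π · inner z
  inner-move π z = inner-joinΣ _ _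

  move-inverse : ∀ π z → move π (move (inverse π) z) ≡ z
  move-inverse π z = begin
    move π (move (inverse π) z)
      ≡⟨ cong (λ q → joinΣ M c (proj₁ q , π (proj₁ q) ⟨$⟩ʳ proj₂ q)) (splitΣ-joinΣ M c _) ⟩
    joinΣ M c (part z , π _ ⟨$⟩ʳ (inverse π _ ⟨$⟩ʳ proj₂ (splitΣ M c z)))
      ≡⟨ cong (λ a → joinΣ M c (part z , a)) (inverseʳ (π _)) ⟩
    joinΣ M c (splitΣ M c z)
      ≡⟨ joinΣ-splitΣ M c z ⟩
    z ∎
    where open ≡-Reasoning

  countInner-act : ∀ π P → countInner (λ u → P (π · u)) ≡ countInner P
  countInner-act π P = begin
    count S (λ z → P (π · inner z))      ≡⟨ count-cong S (λ z → cong P (inner-move π z)) ⟨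
    count S (λ z → P (inner (move π z))) ≡⟨ count-permute S (P ∘ inner) movement ⟩
    count S (P ∘ inner)                  ∎
    where
    open ≡-Reasoning
    movement : Permutation′ S
    movement = permutation (move π) (move (inverse π)) (move-inverse π) (move-inverse (inverse π))

  SameOrbit-sym : ∀ {A B} → SameOrbit {M} {n} A B → SameOrbit B A
  SameOrbit-sym {o , _} {o′ , _} (π , o′∘π≡o) = inverse π , λ u v →
    trans (sym (o′∘π≡o (inverse π · u) (inverse π · v))) (cong₂ o′ (act-inverse π u) (act-inverse π v))

  SameOrbit-trans : ∀ {A B C} → SameOrbit {M} {n} A B → SameOrbit B C → SameOrbit A C
  SameOrbit-trans {o , _} {o′ , _} {o″ , _} (π , o′∘π≡o) (ρ , o″∘ρ≡o′) =
    (λ i → π i ∘ₚ ρ i) , λ u v →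
      trans (cong₂ o″ (act-∘ u) (act-∘ v)) (trans (o″∘ρ≡o′ (π · u) (π · v)) (o′∘π≡o u v))
    where
    act-∘ : ∀ u → (λ i → π i ∘ₚ ρ i) · u ≡ ρ · π · u
    act-∘ (zero  , a) = refl
    act-∘ (suc i , a) = refl

  ≗⇒SameOrbit : ∀ {A B : AcyclicOrientation M n} → (∀ u v → proj₁ A u v ≡ proj₁ B u v) → SameOrbit A B
  ≗⇒SameOrbit {o , _} {o′ , _} o≗o′ = (λ _ → Perm.id) , λ u v →
    trans (cong₂ o′ (act-id u) (act-id v)) (sym (o≗o′ u v))
    where
    act-id : ∀ u → (λ _ → Perm.id) · u ≡ u
    act-id (zero  , a) = refl
    act-id (suc i , a) = refl

-- Canonical orientations

module Canonical {M : ℕ} {n : Fin (suc M) → ℕ} where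
  open Parts {M} {n}

  inflow : (Vertex M n → Vertex M n → Bool) → Vertex M n → ℕ
  inflow o u = countInner (λ v → o v u)

  inflow-invariant : ∀ {A B} → ((π , _) : SameOrbit {M} {n} A B) →
                     ∀ u → inflow (proj₁ B) (act π u) ≡ inflow (proj₁ A) u
  inflow-invariant {o , _} {o′ , _} (π , o′∘π≡o) u =
    trans (sym (countInner-act π (λ v → o′ v (act π u)))) (count-cong S (λ z → o′∘π≡o (inner z) u))

  -- V₁ is part zero and V_{i+2} is part suc i.  Vertex k of part suc i sits at height 2t+1, where t is the
  -- position of the k-th letter i of w, and vertex a of V₁ at height 2 (p a), in the gap just before position p a.
  canonicalHeight : Vec (Fin M) S → (Fin (n zero) → Fin (suc S)) → Vertex M n → ℕ
  canonicalHeight w p (zero  , a) = 2 * toℕ (p a)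
  canonicalHeight w p (suc i , a) = suc (2 * position w i (toℕ a))

  module _ (w : Vec (Fin M) S) (w∈c : HasCounts w c) (p : Fin (n zero) → Fin (suc S)) where
    open Upward (canonicalHeight w p)

    canonicalHeight-injective : ∀ u v → Adj u v → canonicalHeight w p u ≢ canonicalHeight w p v
    canonicalHeight-injective (zero  , a) (zero  , b) 0≢0 = contradiction refl 0≢0
    canonicalHeight-injective (zero  , a) (suc j , b) _   = even≢odd (toℕ (p a)) (position w j (toℕ b))
    canonicalHeight-injective (suc i , a) (zero  , b) _   = even≢odd (toℕ (p b)) (position w i (toℕ a)) ∘ sym
    canonicalHeight-injective (suc i , a) (suc j , b) i≢j =
      i≢j ∘ cong suc ∘ position-injectiveˡ w w∈c i j a b
          ∘ *-cancelˡ-≡ (position w i (toℕ a)) (position w j (toℕ b)) 2 ∘ suc-injective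

    canonical : AcyclicOrientation M n
    canonical = upward , upward-isOrientation canonicalHeight-injective , upward-acyclic

    inflow-V₁ : ∀ a → inflow upward (zero , a) ≡ toℕ (p a)
    inflow-V₁ a = begin
      inflow upward (zero , a)
        ≡⟨ countInner-parts (λ v → upward v (zero , a)) ⟩
      Σ[< M ] (λ j → count (c j) (λ b → does (suc (2 * position w j (toℕ b)) <? 2 * toℕ (p a))))
        ≡⟨ Σ-cong M (λ j → count-cong (c j) (λ b → <?-cong (odd<even⇔< (position w j (toℕ b)) (toℕ (p a))))) ⟩
      Σ[< M ] (λ j → count (c j) (λ b → does (position w j (toℕ b) <? toℕ (p a))))
        ≡⟨ Σ-count-position< w w∈c (toℕ (p a)) (s≤s⁻¹ (toℕ<n (p a))) ⟩
      toℕ (p a) ∎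
      where open ≡-Reasoning

    inflow-inner : ∀ i (k : Fin (c i)) → inflow upward (suc i , k) + toℕ k ≡ position w i (toℕ k)
    inflow-inner i k = begin
      inflow upward (suc i , k) + toℕ k
        ≡⟨ cong₂ _+_ (countInner-parts (λ v → upward v (suc i , k))) (sym within-part) ⟩
      Σ[< M ] (λ j → count (c j) (λ b → not (does (j Fin.≟ i)) ∧ earlier j b))
        + Σ[< M ] (λ j → count (c j) (λ b → does (j Fin.≟ i) ∧ earlier j b))
        ≡⟨ Σ-distrib-+ M _ _ ⟨
      Σ[< M ] (λ j → count (c j) (λ b → not (does (j Fin.≟ i)) ∧ earlier j b)
                     + count (c j) (λ b → does (j Fin.≟ i) ∧ earlier j b))
        ≡⟨ Σ-cong M (λ j → count-partition (c j) (λ _ → does (j Fin.≟ i)) (earlier j)) ⟨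
      Σ[< M ] (λ j → count (c j) (earlier j))
        ≡⟨ Σ-cong M (λ j → count-cong (c j) (earlier≡ j)) ⟩
      Σ[< M ] (λ j → count (c j) (λ b → does (position w j (toℕ b) <? position w i (toℕ k))))
        ≡⟨ Σ-count-position< w w∈c _ (<⇒≤ (position<length w w∈c i k)) ⟩
      position w i (toℕ k) ∎
      where
      open ≡-Reasoning
      earlier : ∀ j → Fin (c j) → Bool
      earlier j b = does (canonicalHeight w p (suc j , b) <? canonicalHeight w p (suc i , k))
      earlier≡ : ∀ j b → earlier j b ≡ does (position w j (toℕ b) <? position w i (toℕ k))
      earlier≡ j b = <?-cong (odd<odd⇔< (position w j (toℕ b)) (position w i (toℕ k)))
      within-part : Σ[< M ] (λ j → count (c j) (λ b → does (j Fin.≟ i) ∧ earlier j b)) ≡ toℕ k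
      within-part = begin
        Σ[< M ] (λ j → count (c j) (λ b → does (j Fin.≟ i) ∧ earlier j b))
          ≡⟨ Σ-single M _ i (λ j j≢i → count-none (c j) _ (λ b → cong (_∧ earlier j b) (dec-false (j Fin.≟ i) j≢i))) ⟩
        count (c i) (λ b → does (i Fin.≟ i) ∧ earlier i b)
          ≡⟨ count-cong (c i) (λ b → cong₂ _∧_ (dec-true (i Fin.≟ i) refl) (earlier≡ i b)) ⟩
        count (c i) (λ b → does (position w i (toℕ b) <? position w i (toℕ k)))
          ≡⟨ count-cong (c i) (λ b → <?-cong (position<⇔< w w∈c i b k)) ⟩
        count (c i) (λ b → does (toℕ b <? toℕ k))
          ≡⟨ count-toℕ< (c i) (toℕ k) (<⇒≤ (toℕ<n k)) ⟩
        toℕ k ∎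

    inflow-monotone : ∀ i → Monotone (λ k → inflow upward (suc i , k))
    inflow-monotone i a b a≤b = count-mono S (λ z → upward-≤ (inner z) {suc i} {a} {b}
      (s≤s (*-monoʳ-≤ 2 (position-mono-≤ w w∈c i a b a≤b))))

  canonical-injective : ∀ w (w∈c : HasCounts w c) p w′ (w′∈c : HasCounts w′ c) p′ →
                        SameOrbit (canonical w w∈c p) (canonical w′ w′∈c p′) → w ≡ w′ × (∀ a → p a ≡ p′ a)
  canonical-injective w w∈c p w′ w′∈c p′ orbit@(π , _) = same-word , same-slot
    where
    A = canonical w w∈c p
    B = canonical w′ w′∈c p′

    same-slot : ∀ a → p a ≡ p′ a
    same-slot a = toℕ-injective (begin
      toℕ (p a)                                          ≡⟨ inflow-V₁ w w∈c p a ⟨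
      inflow (proj₁ A) (zero , a)      ≡⟨ inflow-invariant {A} {B} orbit (zero , a) ⟨
      inflow (proj₁ B) (zero , a)   ≡⟨ inflow-V₁ w′ w′∈c p′ a ⟩
      toℕ (p′ a)                                         ∎)
      where open ≡-Reasoning

    same-position : ∀ i (k : Fin (c i)) → position w i (toℕ k) ≡ position w′ i (toℕ k)
    same-position i k = begin
      position w i (toℕ k)                                      ≡⟨ inflow-inner w w∈c p i k ⟨
      inflow (proj₁ A) (suc i , k) + toℕ k    ≡⟨ cong (_+ toℕ k) same-inflow ⟩
      inflow (proj₁ B) (suc i , k) + toℕ k ≡⟨ inflow-inner w′ w′∈c p′ i k ⟩
      position w′ i (toℕ k)                                     ∎
      where
      open ≡-Reasoning
      same-inflow = monotone-permutation-unique (c i) _ _ (π i)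
        (inflow-monotone w w∈c p i) (inflow-monotone w′ w′∈c p′ i)
        (λ k → sym (inflow-invariant {A} {B} orbit (suc i , k))) k

    same-word : w ≡ w′
    same-word = position-ext w w′ (λ j → trans (w∈c j) (sym (w′∈c j))) λ i l l<occ →
      let l<c = subst (l <_) (w∈c i) l<occ in
      subst (λ x → position w i x ≡ position w′ i x) (toℕ-fromℕ< l<c) (same-position i (fromℕ< l<c))

-- Reduction to canonical form

any-vertex? : ∀ {M n} {P : Vertex M n → Set} → (∀ u → Dec (P u)) → Dec (∃ P)
any-vertex? P? = map′ (λ (i , a , p) → (i , a) , p) (λ ((i , a) , p) → i , a , p)
  (Finₚ.any? λ i → Finₚ.any? λ a → P? (i , a))

module Normalize {M : ℕ} {n : Fin (suc M) → ℕ} (o : Vertex M n → Vertex M n → Bool)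
                 (o-orientation : IsOrientation o) (o-acyclic : Acyclic o) where
  open Parts {M} {n}
  open Canonical {M} {n}

  _⇒_ : Vertex M n → Vertex M n → Set
  u ⇒ v = o u v ≡ true

  _⇒⁺_ : Vertex M n → Vertex M n → Set
  _⇒⁺_ = TransClosure _⇒_

  ⇒-adjacent : ∀ {u v} → u ⇒ v → Adj u v
  ⇒-adjacent {u} {v} u⇒v same = contradiction (trans (sym u⇒v) (proj₁ (o-orientation u v) same)) λ ()

  ⇒-reverse : ∀ u v → Adj u v → o u v ≡ false → v ⇒ u
  ⇒-reverse u v u≢v ouv = trans (proj₂ (o-orientation v u) (u≢v ∘ sym)) (cong not ouv)

  ⇒⁺-adjacent : ∀ {u v} → u ⇒⁺ v → Adj u v → u ⇒ v
  ⇒⁺-adjacent {u} {v} u⇒⁺v u≢v with o u v in ouv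
  ... | true  = refl
  ... | false = contradiction (⇒-reverse u v u≢v ouv ∷ u⇒⁺v) (o-acyclic v)

  -- The first step of a path leaves the part of u, hence of v, and then goes on to v directly.
  ⇒⁺-same-part : ∀ {u v} → u ⇒⁺ v → proj₁ u ≡ proj₁ v → ∃ λ y → u ⇒ y × y ⇒ v
  ⇒⁺-same-part [ u⇒v ]        same = contradiction same (⇒-adjacent u⇒v)
  ⇒⁺-same-part (u⇒y ∷ y⇒⁺v) same = _ , u⇒y , ⇒⁺-adjacent y⇒⁺v (λ y≡v → ⇒-adjacent u⇒y (trans same (sym y≡v)))

  _⇒⁺?_ : ∀ u v → Dec (u ⇒⁺ v)
  u ⇒⁺? v with proj₁ u Fin.≟ proj₁ v
  ... | no u≢v = map′ [_] (λ p → ⇒⁺-adjacent p u≢v) (o u v ≟ᵇ true)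
  ... | yes same = map′ (λ (y , u⇒y , y⇒v) → u⇒y ∷ [ y⇒v ]) (λ p → ⇒⁺-same-part p same)
    (any-vertex? λ y → (o u y ≟ᵇ true) ×-dec (o y v ≟ᵇ true))

  depth : Vertex M n → ℕ
  depth u = countInner (λ v → does (v ⇒⁺? u))

  depth-mono : ∀ {u v} → u ⇒⁺ v → depth u ≤ depth v
  depth-mono {u} {v} u⇒⁺v = count-mono S λ z z⇒⁺u →
    dec-true (inner z ⇒⁺? v) (dec-true⁻¹ (inner z ⇒⁺? u) z⇒⁺u ++ u⇒⁺v)

  depth-mono-< : ∀ {z v} → inner z ⇒⁺ v → depth (inner z) < depth v
  depth-mono-< {z} {v} z⇒⁺v = count-mono-< S
    (λ z′ z′⇒⁺z → dec-true (inner z′ ⇒⁺? v) (dec-true⁻¹ (inner z′ ⇒⁺? inner z) z′⇒⁺z ++ z⇒⁺v))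
    z (dec-false (inner z ⇒⁺? inner z) (o-acyclic (inner z))) (dec-true (inner z ⇒⁺? v) z⇒⁺v)

  -- Vertices outside V₁ are ranked by depth; ties can only occur within a part, so their breaking is irrelevant.
  open Ranking (tiebreak (depth ∘ inner)) (tiebreak-injective (depth ∘ inner))

  inner⇒inner : ∀ {z z′} → inner z ⇒ inner z′ → rankℕ z < rankℕ z′
  inner⇒inner z⇒z′ = rankℕ-mono (tiebreak-mono (depth ∘ inner) (depth-mono-< [ z⇒z′ ]))

  inner⇒V₁ : ∀ {z} a → inner z ⇒ (zero , a) → rankℕ z < depth (zero , a)
  inner⇒V₁ {z} a z⇒a = count-mono-< S ranked-lower⇒reaches z
    (dec-false (tiebreak (depth ∘ inner) z <? tiebreak (depth ∘ inner) z) (<-irrefl refl))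
    (dec-true (inner z ⇒⁺? (zero , a)) [ z⇒a ])
    where
    ranked-lower⇒reaches : ∀ z′ → does (tiebreak (depth ∘ inner) z′ <? tiebreak (depth ∘ inner) z) ≡ true →
                           does (inner z′ ⇒⁺? (zero , a)) ≡ true
    ranked-lower⇒reaches z′ lower with inner z′ ⇒⁺? (zero , a)
    ... | yes z′⇒⁺a = dec-true (inner z′ ⇒⁺? (zero , a)) z′⇒⁺a
    ... | no z′⇏a = contradiction (begin-strict
      depth (zero , a)  ≤⟨ depth-mono [ ⇒-reverse (inner z′) (zero , a) (λ ()) (¬-not (z′⇏a ∘ [_])) ] ⟩
      depth (inner z′)  ≤⟨ tiebreak<⇒≤ (depth ∘ inner) (dec-true⁻¹ (_ <? _) lower) ⟩
      depth (inner z)   <⟨ depth-mono-< [ z⇒a ] ⟩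
      depth (zero , a)  ∎) (<-irrefl refl)
      where open ≤-Reasoning

  V₁⇒inner : ∀ {z} a → (zero , a) ⇒ inner z → depth (zero , a) ≤ rankℕ z
  V₁⇒inner {z} a a⇒z = count-mono S λ z′ z′⇒⁺a → dec-true (_ <? _)
    (tiebreak-mono (depth ∘ inner) (<-≤-trans (depth-mono-< (dec-true⁻¹ (inner z′ ⇒⁺? (zero , a)) z′⇒⁺a))
                                              (depth-mono [ a⇒z ])))

  height : Vertex M n → ℕ
  height (zero  , a) = 2 * depth (zero , a)
  height (suc i , a) = suc (2 * rankℕ (joinΣ M c (i , a)))

  height-mono : ∀ u v → u ⇒ v → height u < height v
  height-mono (zero  , a) (zero  , b) a⇒b = contradiction refl (⇒-adjacent a⇒b)
  height-mono (zero  , a) (suc j , b) a⇒b = Equivalence.from (even<odd⇔≤ _ _)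
    (V₁⇒inner a (subst ((zero , a) ⇒_) (sym (inner-joinΣ j b)) a⇒b))
  height-mono (suc i , a) (zero  , b) a⇒b = Equivalence.from (odd<even⇔< _ _)
    (inner⇒V₁ b (subst (_⇒ (zero , b)) (sym (inner-joinΣ i a)) a⇒b))
  height-mono (suc i , a) (suc j , b) a⇒b = Equivalence.from (odd<odd⇔< _ _)
    (inner⇒inner (subst₂ _⇒_ (sym (inner-joinΣ i a)) (sym (inner-joinΣ j b)) a⇒b))

  o≡upward : ∀ u v → o u v ≡ Upward.upward height u v
  o≡upward = Upward.upward-unique height o o-orientation height-mono

  letter : Fin S → Fin M
  letter t = part (rankPermutation ⟨$⟩ˡ t)

  word : Vec (Fin M) S
  word = tabulate letter

  letter-rank : ∀ z → letter (rank z) ≡ part z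
  letter-rank z = cong part (inverseˡ rankPermutation)

  lookup-word-rank : ∀ z → lookup word (rank z) ≡ part z
  lookup-word-rank z = trans (lookup∘tabulate letter (rank z)) (letter-rank z)

  before-word : ∀ i t → before word i t ≡ count S (λ z → does (rankℕ z <? t) ∧ does (part z Fin.≟ i))
  before-word i t = begin
    before word i t
      ≡⟨ before-tabulate S _ i t ⟩
    count S (λ s → does (toℕ s <? t) ∧ does (letter s Fin.≟ i))
      ≡⟨ count-permute S _ rankPermutation ⟨
    count S (λ z → does (toℕ (rank z) <? t) ∧ does (letter (rank z) Fin.≟ i))
      ≡⟨ count-cong S (λ z → cong₂ (λ x j → does (x <? t) ∧ does (j Fin.≟ i)) (toℕ-rank z) (letter-rank z)) ⟩
    count S (λ z → does (rankℕ z <? t) ∧ does (part z Fin.≟ i)) ∎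
    where open ≡-Reasoning

  word-counts : HasCounts word c
  word-counts j = begin
    occurrences word j
      ≡⟨ before-length word j ⟨
    before word j S
      ≡⟨ before-word j S ⟩
    count S (λ z → does (rankℕ z <? S) ∧ does (part z Fin.≟ j))
      ≡⟨ count-cong S (λ z → cong (_∧ does (part z Fin.≟ j)) (dec-true (rankℕ z <? S) (rankℕ<k z))) ⟩
    count S (λ z → true ∧ does (part z Fin.≟ j))
      ≡⟨ count-splitΣ-part M c (λ _ → true) j ⟩
    count (c j) (λ _ → true)
      ≡⟨ count-all (c j) _ (λ _ → refl) ⟩
    c j ∎
    where open ≡-Reasoning

  rankInPart : ∀ i → Fin (c i) → ℕ
  rankInPart i a = rankℕ (joinΣ M c (i , a))

  rankInPart-injective : ∀ i → Injective _≡_ _≡_ (rankInPart i)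
  rankInPart-injective i {a} {b} eq = toℕ-injective (cong (toℕ ∘ proj₂)
    (trans (sym (splitΣ-joinΣ M c (i , a))) (trans (cong (splitΣ M c) (rankℕ-injective eq)) (splitΣ-joinΣ M c (i , b)))))

  π : PartPerm M n
  π i = Ranking.rankPermutation (rankInPart i) (rankInPart-injective i)

  position-before-rank : ∀ z → position word (part z) (before word (part z) (rankℕ z)) ≡ rankℕ z
  position-before-rank z = subst₂ (λ j x → position word j (before word j x) ≡ x) (lookup-word-rank z) (toℕ-rank z)
    (position-before word (rank z))

  earlier-in-part : ∀ i a → count (c i) (λ b → does (rankInPart i b <? rankInPart i a)) ≡ before word i (rankInPart i a)
  earlier-in-part i a = begin
    count (c i) (λ b → does (rankInPart i b <? r))
      ≡⟨ count-splitΣ-part M c (λ q → does (rankℕ (joinΣ M c q) <? r)) i ⟨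
    count S (λ z′ → does (rankℕ (joinΣ M c (splitΣ M c z′)) <? r) ∧ does (part z′ Fin.≟ i))
      ≡⟨ count-cong S (λ z′ → cong (λ y → does (rankℕ y <? r) ∧ does (part z′ Fin.≟ i)) (joinΣ-splitΣ M c z′)) ⟩
    count S (λ z′ → does (rankℕ z′ <? r) ∧ does (part z′ Fin.≟ i))
      ≡⟨ before-word i r ⟨
    before word i r ∎
    where
    open ≡-Reasoning
    r = rankInPart i a

  position-word : ∀ i a → position word i (toℕ (π i ⟨$⟩ʳ a)) ≡ rankInPart i a
  position-word i a = begin
    position word i (toℕ (π i ⟨$⟩ʳ a))
      ≡⟨ cong (position word i) (Ranking.toℕ-rank (rankInPart i) (rankInPart-injective i) a) ⟩
    position word i (count (c i) (λ b → does (rankInPart i b <? rankInPart i a)))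
      ≡⟨ cong (position word i) (earlier-in-part i a) ⟩
    position word i (before word i (rankInPart i a))
      ≡⟨ subst (λ j → position word j (before word j (rankℕ z)) ≡ rankℕ z) (cong proj₁ (splitΣ-joinΣ M c (i , a)))
               (position-before-rank z) ⟩
    rankInPart i a ∎
    where
    open ≡-Reasoning
    z = joinΣ M c (i , a)
  depth≤S : ∀ u → depth u ≤ S
  depth≤S u = count≤ S (λ v → does (inner v ⇒⁺? u))

  slot : Fin (n zero) → Fin (suc S)
  slot a = fromℕ< (s≤s (depth≤S (zero , a)))

  canonicalHeight-act : ∀ u → canonicalHeight word slot (act π u) ≡ height u
  canonicalHeight-act (zero  , a) = cong (2 *_) (toℕ-fromℕ< (s≤s (depth≤S (zero , a))))
  canonicalHeight-act (suc i , a) = cong (λ x → suc (2 * x)) (position-word i a)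

  normalForm : SameOrbit (o , o-orientation , o-acyclic) (canonical word word-counts slot)
  normalForm = π , λ u v → begin
    Upward.upward (canonicalHeight word slot) (act π u) (act π v) ≡⟨ upward-act (canonicalHeight word slot) π u v ⟩
    Upward.upward (canonicalHeight word slot ∘ act π) u v         ≡⟨ upward-cong canonicalHeight-act u v ⟩
    Upward.upward height u v                                      ≡⟨ o≡upward u v ⟨
    o u v                                                         ∎
    where open ≡-Reasoning

-- Counting the orbits

normalForm⇒HasClasses : ∀ {A : Set} {_~_ : A → A → Set} {k} →
  (∀ {a b} → a ~ b → b ~ a) → (∀ {a b c} → a ~ b → b ~ c → a ~ c) →
  (f : Fin k → A) (g : A → Fin k) → (∀ a → a ~ f (g a)) → (∀ i j → f i ~ f j → i ≡ j) → HasClasses A _~_ k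
normalForm⇒HasClasses ~-sym ~-trans f g a~fga f-injective =
  f , g , respects , (λ i → f-injective _ i (~-sym (a~fga (f i)))) , (λ a → ~-sym (a~fga a))
  where
  respects : ∀ a b → _ → g a ≡ g b
  respects a b a~b = f-injective _ _ (~-trans (~-sym (a~fga a)) (~-trans a~b (a~fga b)))

funToFin-cong : ∀ {m k} {f g : Fin m → Fin k} → (∀ a → f a ≡ g a) → Fin.funToFin f ≡ Fin.funToFin g
funToFin-cong {zero}  f≗g = refl
funToFin-cong {suc m} f≗g = cong₂ Fin.combine (f≗g zero) (funToFin-cong (f≗g ∘ suc))

module Orbits (M : ℕ) (n : Fin (suc M) → ℕ) where
  open Parts {M} {n}
  open Canonical {M} {n}

  canonical-cong : ∀ {w w′} (w∈c : HasCounts w c) (w′∈c : HasCounts w′ c) {p p′} → w ≡ w′ → (∀ a → p a ≡ p′ a) →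
                   ∀ u v → proj₁ (canonical w w∈c p) u v ≡ proj₁ (canonical w′ w′∈c p′) u v
  canonical-cong {w} w∈c w′∈c {p} {p′} refl p≗p′ = upward-cong {h = canonicalHeight w p} {canonicalHeight w p′} λ where
    (zero  , a) → cong (λ x → 2 * toℕ x) (p≗p′ a)
    (suc i , a) → refl

  Index : Set
  Index = Fin ((1 + S) ^ n zero * multinomial M c)

  wordCount≡multinomial : wordCount S c ≡ multinomial M c
  wordCount≡multinomial = sym (multinomial≡wordCount c)

  fromIndex : Index → AcyclicOrientation M n
  fromIndex i = canonical (decode S c z) (decode-counts S c refl z) (Fin.finToFun (Fin.quotient _ i))
    where z = Fin.cast (sym wordCount≡multinomial) (Fin.remainder {(1 + S) ^ n zero} _ i)

  toIndex : AcyclicOrientation M n → Index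
  toIndex (o , o-orientation , o-acyclic) =
    Fin.combine (Fin.funToFin slot) (Fin.cast wordCount≡multinomial (encode S c word word-counts))
    where open Normalize o o-orientation o-acyclic

  encode-cong : ∀ {w w′} → w ≡ w′ → .(w∈c : HasCounts w c) .(w′∈c : HasCounts w′ c) →
                encode S c w w∈c ≡ encode S c w′ w′∈c
  encode-cong refl _ _ = refl

  toIndex-normalForm : ∀ A → SameOrbit A (fromIndex (toIndex A))
  toIndex-normalForm A@(o , o-orientation , o-acyclic) =
    SameOrbit-trans {A} {canonical word word-counts slot} {fromIndex (toIndex A)} normalForm
      (≗⇒SameOrbit {canonical word word-counts slot} {fromIndex (toIndex A)}
        (canonical-cong word-counts (decode-counts S c refl _) same-word same-slot))
    where
    open Normalize o o-orientation o-acyclic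
    encoded = Fin.cast wordCount≡multinomial (encode S c word word-counts)
    split = Finₚ.remQuot-combine {n = (1 + S) ^ n zero} {k = multinomial M c} (Fin.funToFin slot) encoded
    same-slot : ∀ a → slot a ≡ Fin.finToFun (Fin.quotient _ (toIndex A)) a
    same-slot a = sym (trans (cong (λ q → Fin.finToFun (proj₁ q) a) split) (Finₚ.finToFun-funToFin slot a))
    same-word : word ≡ decode S c (Fin.cast (sym wordCount≡multinomial) (Fin.remainder {(1 + S) ^ n zero} _ (toIndex A)))
    same-word = sym (begin
      decode S c (Fin.cast _ (Fin.remainder {(1 + S) ^ n zero} _ (toIndex A)))
        ≡⟨ cong (λ q → decode S c (Fin.cast (sym wordCount≡multinomial) (proj₂ q))) split ⟩
      decode S c (Fin.cast _ encoded)
        ≡⟨ cong (decode S c) (Finₚ.cast-involutive (sym wordCount≡multinomial) wordCount≡multinomial _) ⟩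
      decode S c (encode S c word word-counts)
        ≡⟨ decode-encode S c word word-counts ⟩
      word ∎)
      where open ≡-Reasoning

  fromIndex-injective : ∀ i j → SameOrbit (fromIndex i) (fromIndex j) → i ≡ j
  fromIndex-injective i j orbit = begin
    i                                         ≡⟨ Finₚ.combine-remQuot {(1 + S) ^ n zero} _ i ⟨
    Fin.combine (quotient i) (remainder i)    ≡⟨ cong₂ Fin.combine same-quotient same-remainder ⟩
    Fin.combine (quotient j) (remainder j)    ≡⟨ Finₚ.combine-remQuot {(1 + S) ^ n zero} _ j ⟩
    j                                         ∎
    where
    open ≡-Reasoning
    quotient = Fin.quotient {(1 + S) ^ n zero} (multinomial M c)
    remainder = Fin.remainder {(1 + S) ^ n zero} (multinomial M c)
    z : Index → Fin (wordCount S c)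
    z k = Fin.cast (sym wordCount≡multinomial) (remainder k)
    same = canonical-injective (decode S c (z i)) (decode-counts S c refl (z i)) (Fin.finToFun (quotient i))
                               (decode S c (z j)) (decode-counts S c refl (z j)) (Fin.finToFun (quotient j)) orbit
    same-quotient : quotient i ≡ quotient j
    same-quotient = trans (sym (Finₚ.funToFin-finToFin {n zero} {suc S} (quotient i)))
                          (trans (funToFin-cong (proj₂ same)) (Finₚ.funToFin-finToFin {n zero} {suc S} (quotient j)))
    same-z : z i ≡ z j
    same-z = trans (sym (encode-decode S c (z i) (decode-counts S c refl (z i))))
                   (trans (encode-cong (proj₁ same) _ (decode-counts S c refl (z j)))
                          (encode-decode S c (z j) (decode-counts S c refl (z j))))
    same-remainder : remainder i ≡ remainder j
    same-remainder = trans (sym (Finₚ.cast-involutive wordCount≡multinomial _ (remainder i)))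
                           (trans (cong (Fin.cast wordCount≡multinomial) same-z)
                                  (Finₚ.cast-involutive wordCount≡multinomial _ (remainder j)))

lemma6p3 : (M : ℕ) → 1 ≤ M → (n : Fin (suc M) → ℕ) → ((i : Fin M) → 1 ≤ n (suc i)) →
    HasClasses (AcyclicOrientation M n) SameOrbit
      ((1 + Σ[< M ] (λ i → n (suc i))) ^ n zero * multinomial M (λ i → n (suc i)))
lemma6p3 M _ n _ = normalForm⇒HasClasses (λ {A} {B} → SameOrbit-sym {A} {B}) (λ {A} {B} {C} → SameOrbit-trans {A} {B} {C})
  fromIndex toIndex toIndex-normalForm fromIndex-injective
  where
  open Parts {M} {n}
  open Orbits M n
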